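{- Let $\mathbf A$ be a partial structure and $\mathbf B$ a partial substructure of $\mathbf A$. Then every existential sentence (with parameters from the universe of $\mathbf B$) verified by $\mathbf B$ is verified by $\mathbf A$.
   Context: Fix a language $L$. A partial $L$-structure $\mathbf A$ with universe $A$ interprets each function symbol $S$ as a map $A^{ar(S)}\to A\cup\{1/2\}$ and each relation symbol as a map $A^{ar(S)}\to\{0,1,1/2\}$, where $1/2\notin A$ means "undefined". $\mathbf B$ (universe $B$) is a partial substructure of $\mathbf A$ if $B\subseteq A$ and each $S^B$ is obtained from the restriction of $S^A$ to $B^{ar(S)}$ by changing some values to $1/2$ (in particular function values not in $B$ must become $1/2$). Truth values $v^{\mathbf A}(\varphi)\in\{0,1,1/2\}$ of sentences with parameters: interpretations are extended by value $1/2$ on argument tuples containing $1/2$, so closed terms evaluate to $1/2$ once a subterm does; $t=s$ gets $1/2$ if $t^A$ or $s^A$ is $1/2$, else $1$ or $0$ according to equality; $S(t_0,\dots)$ gets $S^A(t_0^A,\dots)$; $v(\neg\varphi)=1-v(\varphi)$; $v(\varphi\wedge\psi)=\min$; $v(\forall x\varphi(x))=\min_{a\in A}v(\varphi(a))$; $\vee$ and $\exists$ are the classical duals (max). $\mathbf A$ verifies $\varphi$ if $v^{\mathbf A}(\varphi)=1$. -}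

module Defs where

open import Data.Nat using (ℕ; zero; suc)
open import Data.Fin using (Fin)
open import Data.Vec using (Vec; []; _∷_; map; lookup)
open import Data.Maybe using (Maybe; just; nothing; _>>=_)
open import Data.Product using (Σ; _×_; _,_)
open import Data.Sum using (_⊎_)
open import Relation.Binary.PropositionalEquality using (_≡_; _≢_)
open import Function.Definitions using (Injective)

data TV : Set where
  𝟘 𝟙 ½ : TV

record Language : Set₁ where
  field
    FunSym : Set
    RelSym : Set
    funAr  : FunSym → ℕ
    relAr  : RelSym → ℕ

module _ (L : Language) where
  open Language L

  -- Partial L-structures.  A function value 'nothing' is the value 1/2
  -- ("undefined"), which is not an element of the universe.

  record PartialStructure : Set₁ where
    field
      Carrier : Set
      fun     : (f : FunSym) → Vec Carrier (funAr f) → Maybe Carrier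
      rel     : (r : RelSym) → Vec Carrier (relAr r) → TV

  open PartialStructure

  -- The inclusion B ⊆ A is given by
  -- an injective map ι (B identified with its image).  Each S^B is the
  -- restriction of S^A to B with some values changed to 1/2; in
  -- particular a function value of S^B is either undefined or equal to
  -- the (then necessarily B-valued) value of S^A.

  record IsPartialSubstructure (B A : PartialStructure) : Set where
    field
      ι     : Carrier B → Carrier A
      ι-inj : Injective _≡_ _≡_ ι
      fun-restr : ∀ f (bs : Vec (Carrier B) (funAr f)) →
        (fun B f bs ≡ nothing) ⊎
        (Σ (Carrier B) λ b → (fun B f bs ≡ just b) × (fun A f (map ι bs) ≡ just (ι b)))
      rel-restr : ∀ r (bs : Vec (Carrier B) (relAr r)) →
        (rel B r bs ≡ ½) ⊎ (rel B r bs ≡ rel A r (map ι bs))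

  -- Syntax: terms and formulas with parameters from P and n free
  -- (de Bruijn) variables.  Sentences with parameters: Formula P 0.

  data Term (P : Set) (n : ℕ) : Set where
    var : Fin n → Term P n
    par : P → Term P n
    app : (f : FunSym) → Vec (Term P n) (funAr f) → Term P n

  data Formula (P : Set) : ℕ → Set where
    _≐_  : ∀ {n} → Term P n → Term P n → Formula P n
    atom : ∀ {n} (r : RelSym) → Vec (Term P n) (relAr r) → Formula P n
    ¬'_  : ∀ {n} → Formula P n → Formula P n
    _∧'_ : ∀ {n} → Formula P n → Formula P n → Formula P n
    _∨'_ : ∀ {n} → Formula P n → Formula P n → Formula P n
    ∀'   : ∀ {n} → Formula P (suc n) → Formula P n
    ∃'   : ∀ {n} → Formula P (suc n) → Formula P n

  data QuantifierFree {P : Set} : ∀ {n} → Formula P n → Set where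
    qf-eq  : ∀ {n} (t s : Term P n) → QuantifierFree (t ≐ s)
    qf-rel : ∀ {n} r (ts : Vec (Term P n) (relAr r)) → QuantifierFree (atom r ts)
    qf-¬   : ∀ {n} {φ : Formula P n} → QuantifierFree φ → QuantifierFree (¬' φ)
    qf-∧   : ∀ {n} {φ ψ : Formula P n} → QuantifierFree φ → QuantifierFree ψ → QuantifierFree (φ ∧' ψ)
    qf-∨   : ∀ {n} {φ ψ : Formula P n} → QuantifierFree φ → QuantifierFree ψ → QuantifierFree (φ ∨' ψ)

  data Existential {P : Set} : ∀ {n} → Formula P n → Set where
    ex-qf : ∀ {n} {φ : Formula P n} → QuantifierFree φ → Existential φ
    ex-∃  : ∀ {n} {φ : Formula P (suc n)} → Existential φ → Existential (∃' φ)

  module Semantics (M : PartialStructure) {P : Set} (π : P → Carrier M) where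

    mutual
      evalT : ∀ {n} → Vec (Carrier M) n → Term P n → Maybe (Carrier M)
      evalT ρ (var i) = just (lookup ρ i)
      evalT ρ (par p) = just (π p)
      evalT ρ (app f ts) = evalTs ρ ts >>= fun M f

      evalTs : ∀ {n k} → Vec (Carrier M) n → Vec (Term P n) k → Maybe (Vec (Carrier M) k)
      evalTs ρ [] = just []
      evalTs ρ (t ∷ ts) = evalT ρ t >>= λ a → evalTs ρ ts >>= λ as → just (a ∷ as)

    -- IsOne ρ φ  : v(φ) = 1 ;  IsZero ρ φ : v(φ) = 0 ; otherwise v(φ) = 1/2.
    -- (Strong Kleene: min for ∧/∀, max for ∨/∃, 1 - v for ¬.)
    mutual
      IsOne : ∀ {n} → Vec (Carrier M) n → Formula P n → Set
      IsOne ρ (t ≐ s) = Σ (Carrier M) λ a → Σ (Carrier M) λ b →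
        (evalT ρ t ≡ just a) × (evalT ρ s ≡ just b) × (a ≡ b)
      IsOne ρ (atom r ts) = Σ (Vec (Carrier M) (relAr r)) λ as →
        (evalTs ρ ts ≡ just as) × (rel M r as ≡ 𝟙)
      IsOne ρ (¬' φ) = IsZero ρ φ
      IsOne ρ (φ ∧' ψ) = IsOne ρ φ × IsOne ρ ψ
      IsOne ρ (φ ∨' ψ) = IsOne ρ φ ⊎ IsOne ρ ψ
      IsOne ρ (∀' φ) = (a : Carrier M) → IsOne (a ∷ ρ) φ
      IsOne ρ (∃' φ) = Σ (Carrier M) λ a → IsOne (a ∷ ρ) φ

      IsZero : ∀ {n} → Vec (Carrier M) n → Formula P n → Set
      IsZero ρ (t ≐ s) = Σ (Carrier M) λ a → Σ (Carrier M) λ b →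
        (evalT ρ t ≡ just a) × (evalT ρ s ≡ just b) × (a ≢ b)
      IsZero ρ (atom r ts) = Σ (Vec (Carrier M) (relAr r)) λ as →
        (evalTs ρ ts ≡ just as) × (rel M r as ≡ 𝟘)
      IsZero ρ (¬' φ) = IsOne ρ φ
      IsZero ρ (φ ∧' ψ) = IsZero ρ φ ⊎ IsZero ρ ψ
      IsZero ρ (φ ∨' ψ) = IsZero ρ φ × IsZero ρ ψ
      IsZero ρ (∀' φ) = Σ (Carrier M) λ a → IsZero (a ∷ ρ) φ
      IsZero ρ (∃' φ) = (a : Carrier M) → IsZero (a ∷ ρ) φ

  Verifies : (M : PartialStructure) {P : Set} (π : P → Carrier M) → Formula P 0 → Set
  Verifies M π φ = Semantics.IsOne M π [] φ

module Submission where

-- Along the inclusion B ⊆ A every defined term value is preserved, and so is every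
-- defined (0 or 1) truth value of a quantifier-free formula: function and relation
-- symbols of B only ever undefine values of A, and injectivity of the inclusion keeps
-- unequal elements unequal.  Truth value 1 of ∃x φ in B has a witness in B, which is
-- also a witness in A.

open import Defs
open import Function using (id; _∘_)
open import Data.Vec using (Vec; []; _∷_; map)
open import Data.Vec.Properties using (lookup-map)
open import Data.Maybe using (just)
open import Data.Maybe.Properties using (just-injective)
open import Data.Product using (_,_)
open import Data.Sum using (inj₁; inj₂)
open import Relation.Nullary using (contradiction)
open import Relation.Binary.PropositionalEquality using (_≡_; _≢_; refl; sym; trans; cong)

module Inclusion (L : Language) {A B : PartialStructure L}
    (sub : IsPartialSubstructure L B A) {P : Set} (π : P → PartialStructure.Carrier B) where
  open PartialStructure
  open IsPartialSubstructure sub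
  module SB = Semantics L B π
  module SA = Semantics L A (ι ∘ π)

  fun-ι : ∀ {f bs b} → fun B f bs ≡ just b → fun A f (map ι bs) ≡ just (ι b)
  fun-ι {f} {bs} defined with fun-restr f bs
  ... | inj₁ undefined = contradiction (trans (sym defined) undefined) λ ()
  ... | inj₂ (b , definedB , definedA)
    rewrite just-injective (trans (sym defined) definedB) = definedA

  rel-ι : ∀ {r bs v} → rel B r bs ≡ v → v ≢ ½ → rel A r (map ι bs) ≡ v
  rel-ι {r} {bs} value v≢½ with rel-restr r bs
  ... | inj₁ undefined = contradiction (trans (sym value) undefined) v≢½
  ... | inj₂ restricted = trans (sym restricted) value

  mutual
    evalT-ι : ∀ {n} (ρ : Vec (Carrier B) n) t {b} → SB.evalT ρ t ≡ just b →
              SA.evalT (map ι ρ) t ≡ just (ι b)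
    evalT-ι ρ (var i) refl = cong just (lookup-map i ι ρ)
    evalT-ι ρ (par p) refl = refl
    evalT-ι ρ (app f ts) defined with SB.evalTs ρ ts in argsDefined
    ... | just bs rewrite evalTs-ι ρ ts argsDefined = fun-ι defined

    evalTs-ι : ∀ {n k} (ρ : Vec (Carrier B) n) (ts : Vec (Term L P n) k) {bs} →
               SB.evalTs ρ ts ≡ just bs → SA.evalTs (map ι ρ) ts ≡ just (map ι bs)
    evalTs-ι ρ [] refl = refl
    evalTs-ι ρ (t ∷ ts) defined with SB.evalT ρ t in headDefined
    ... | just b with SB.evalTs ρ ts in tailDefined
    ...   | just bs with defined
    ...     | refl rewrite evalT-ι ρ t headDefined | evalTs-ι ρ ts tailDefined = refl

  mutual
    isOne-ι : ∀ {n} (ρ : Vec (Carrier B) n) {φ} → QuantifierFree L φ →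
              SB.IsOne ρ φ → SA.IsOne (map ι ρ) φ
    isOne-ι ρ (qf-eq t s) (a , b , ta , sb , a≡b) =
      ι a , ι b , evalT-ι ρ t ta , evalT-ι ρ s sb , cong ι a≡b
    isOne-ι ρ (qf-rel r ts) (as , tsAs , holds) =
      map ι as , evalTs-ι ρ ts tsAs , rel-ι holds λ ()
    isOne-ι ρ (qf-¬ q) h = isZero-ι ρ q h
    isOne-ι ρ (qf-∧ q q') (h , h') = isOne-ι ρ q h , isOne-ι ρ q' h'
    isOne-ι ρ (qf-∨ q q') (inj₁ h) = inj₁ (isOne-ι ρ q h)
    isOne-ι ρ (qf-∨ q q') (inj₂ h) = inj₂ (isOne-ι ρ q' h)

    isZero-ι : ∀ {n} (ρ : Vec (Carrier B) n) {φ} → QuantifierFree L φ →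
               SB.IsZero ρ φ → SA.IsZero (map ι ρ) φ
    isZero-ι ρ (qf-eq t s) (a , b , ta , sb , a≢b) =
      ι a , ι b , evalT-ι ρ t ta , evalT-ι ρ s sb , a≢b ∘ ι-inj
    isZero-ι ρ (qf-rel r ts) (as , tsAs , fails) =
      map ι as , evalTs-ι ρ ts tsAs , rel-ι fails λ ()
    isZero-ι ρ (qf-¬ q) h = isOne-ι ρ q h
    isZero-ι ρ (qf-∧ q q') (inj₁ h) = inj₁ (isZero-ι ρ q h)
    isZero-ι ρ (qf-∧ q q') (inj₂ h) = inj₂ (isZero-ι ρ q' h)
    isZero-ι ρ (qf-∨ q q') (h , h') = isZero-ι ρ q h , isZero-ι ρ q' h'

  isOne-existential-ι : ∀ {n} (ρ : Vec (Carrier B) n) {φ} → Existential L φ →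
                        SB.IsOne ρ φ → SA.IsOne (map ι ρ) φ
  isOne-existential-ι ρ (ex-qf q) h = isOne-ι ρ q h
  isOne-existential-ι ρ (ex-∃ e) (a , h) = ι a , isOne-existential-ι (a ∷ ρ) e h

lemma4p3 : (L : Language) (A B : PartialStructure L)
    (sub : IsPartialSubstructure L B A)
    (φ : Formula L (PartialStructure.Carrier B) 0) →
    Existential L φ →
    Verifies L B id φ →
    Verifies L A (IsPartialSubstructure.ι sub) φ
lemma4p3 L A B sub φ = Inclusion.isOne-existential-ι L sub id []
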